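{- Let $b\ge1$. The map sending $S\in\mathcal{SYT}^{+1}(2\times b)$ to the lattice path $\Gamma$ with $2b+1$ steps whose $j$-th step ($1\le j\le 2b+1$) is: an up step $U=(1,1)$ if $j$ is the minimal entry of a box in the first row of $S$; a down step $D=(1,-1)$ if $j$ is the minimal entry of a box in the second row; a red horizontal step $(1,0)$ if $j$ is a non-minimal entry of a box in the first row; and a blue horizontal step $(1,0)$ if $j$ is a non-minimal entry of a box in the second row, is a bijection from $\mathcal{SYT}^{+1}(2\times b)$ to $\mathrm{RBMotz}(2b+1;1)$.
   Context: $\mathcal{SYT}^{+1}(2\times b)$ is the set of standard barely set-valued tableaux of the $2\times b$ rectangle: fillings of its boxes by nonempty sets partitioning $\{1,\dots,2b+1\}$, exactly one box containing two numbers and the rest one, with $\max S(u)<\min S(v)$ whenever box $u\ne v$ is weakly northwest of $v$. A Motzkin path of length $\ell$ is a lattice path from $(0,0)$ to $(\ell,0)$ with steps $U=(1,1)$, $D=(1,-1)$, $H=(1,0)$ never going below the $x$-axis. A restricted bicolored Motzkin path is a Motzkin path whose horizontal steps are each colored red or blue, such that no red horizontal step occurs at height zero and no blue horizontal step occurs before the first down step. $\mathrm{RBMotz}(\ell;k)$ denotes the set of restricted bicolored Motzkin paths of length $\ell$ with exactly $k$ horizontal steps. -}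

module Defs where

open import Data.Nat using (ℕ; zero; suc; _+_; _*_; _≤_; _<_)
open import Data.Fin using (Fin; toℕ; _<?_) renaming (zero to fzero; suc to fsuc)
open import Data.Fin.Properties using () renaming (_≟_ to _≟F_)
open import Data.Product using (Σ; ∃; ∃-syntax; _×_; _,_; proj₁; proj₂)
open import Data.Product.Properties using (≡-dec)
open import Data.Bool using (Bool; true; false; not; _∧_; if_then_else_)
open import Data.List using (List; []; _∷_; length; filter; map; take; lookup; allFin)
open import Data.Bool.ListAction using (any)
open import Data.Integer using (ℤ; +_; -[1+_]) renaming (_+_ to _+ℤ_; _≤_ to _≤ℤ_)
open import Relation.Nullary using (¬_; does)
open import Relation.Binary.PropositionalEquality using (_≡_; _≢_)
open import Relation.Unary using (Pred)
open import Relation.Nullary.Decidable using (Dec; yes; no)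

-- A box of the 2 × b rectangle: (row, column); row 0 is the first row.
Box : ℕ → Set
Box b = Fin 2 × Fin b

_≟B_ : ∀ {b} (u v : Box b) → Dec (u ≡ v)
_≟B_ = ≡-dec _≟F_ _≟F_

-- The entries 1,…,2b+1 are represented by Fin (2b+1) (entry j ↦ toℕ j + 1,
-- order preserving).  A filling of the boxes by sets partitioning the
-- entries is given by the box containing each entry; the set S(u) of box u
-- is the fibre { j | S j ≡ u }.
Filling : ℕ → Set
Filling b = Fin (2 * b + 1) → Box b

card : ∀ {b} → Filling b → Box b → ℕ
card {b} S u = length (filter (λ j → S j ≟B u) (allFin (2 * b + 1)))

_≼_ : ∀ {b} → Box b → Box b → Set
(r , c) ≼ (r' , c') = (toℕ r ≤ toℕ r') × (toℕ c ≤ toℕ c')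

IsSYT+1 : ∀ {b} → Filling b → Set
IsSYT+1 {b} S =
  (∀ (u : Box b) → ∃[ j ] (S j ≡ u))
  × (∃[ u₀ ] ((card S u₀ ≡ 2) × (∀ u → u ≢ u₀ → card S u ≡ 1)))
  × (∀ (u v : Box b) → u ≢ v → u ≼ v →
       ∀ i j → S i ≡ u → S j ≡ v → toℕ i < toℕ j)

data Step : Set where
  U D red blue : Step

isHoriz : Step → Bool
isHoriz U = false
isHoriz D = false
isHoriz red = true
isHoriz blue = true

Δ : Step → ℤ
Δ U = + 1
Δ D = -[1+ 0 ]
Δ red = + 0
Δ blue = + 0

height : List Step → ℤ
height [] = + 0
height (s ∷ p) = Δ s +ℤ height p

isHorizDec : (s : Step) → Dec (isHoriz s ≡ true)
isHorizDec U = no (λ ())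
isHorizDec D = no (λ ())
isHorizDec red = yes _≡_.refl
isHorizDec blue = yes _≡_.refl

RBMotz : ℕ → ℕ → List Step → Set
RBMotz ℓ k p =
  (length p ≡ ℓ)
  × (∀ (i : ℕ) → i ≤ length p → + 0 ≤ℤ height (take i p))
  × (height p ≡ + 0)
  × (∀ (i : Fin (length p)) → lookup p i ≡ red → height (take (toℕ i) p) ≢ + 0)
  × (∀ (i : Fin (length p)) → lookup p i ≡ blue →
       ∃[ j ] ((toℕ j < toℕ i) × (lookup p j ≡ D)))
  × (length (filter isHorizDec p) ≡ k)

isMinEntry : ∀ {b} → Filling b → Fin (2 * b + 1) → Bool
isMinEntry {b} S j =
  not (any (λ k → does (S k ≟B S j) ∧ does (k <? j)) (allFin (2 * b + 1)))

stepOf : ∀ {b} → Filling b → Fin (2 * b + 1) → Step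
stepOf S j with proj₁ (S j)
... | fzero = if isMinEntry S j then U else red
... | fsuc _ = if isMinEntry S j then D else blue

Γ : ∀ {b} → Filling b → List Step
Γ {b} S = map (stepOf S) (allFin (2 * b + 1))

-- Let N_r(j) be the number of steps among the first j steps of Γ S that open a box of row r
-- (U for the first row, D for the second). Along each row entries increase and no box can be
-- skipped, so after the entries below j row r of a tableau S is filled exactly in its first
-- N_r(j) columns, and entry j sits in column N_r(j+1) − 1 of its row. Column strictness then
-- gives N_2 ≤ N_1 (the path stays weakly above the axis); a non-minimal entry of the first row
-- has the box below it still empty (so its red step is strictly above the axis), and a
-- non-minimal entry of the second row lies in an already opened column (so a down step came
-- earlier); the 2b boxes use 2b of the 2b+1 steps, leaving exactly one horizontal step.
-- Conversely, placing entry j in the row of step j and in column N_r(j+1) − 1 decodes every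
-- path of RBMotz(2b+1;1) into a tableau, and the same formula shows that Γ is injective.

module Submission where

open import Defs
open import Data.Bool using (Bool; true; false; not; _∧_; T; if_then_else_)
open import Data.Bool.Properties using (T-≡; not-injective; not-¬; ¬-not; ∧-zeroʳ; ∧-identityʳ)
open import Data.Bool.ListAction using (any)
open import Data.Empty using (⊥; ⊥-elim)
open import Data.Fin using (Fin; toℕ; fromℕ<) renaming (zero to fzero; suc to fsuc; _<?_ to _<?F_)
open import Data.Fin.Properties using (toℕ-injective; toℕ-fromℕ<; toℕ<n)
  renaming (_≟_ to _≟F_; suc-injective to fsuc-injective)
open import Data.Integer using (0ℤ; _⊖_; +≤+) renaming (_≤_ to _≤ℤ_)
import Data.Integer.Properties as ℤ
open import Data.List using (List; []; _∷_; length; filter; take; lookup; allFin; tabulate)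
open import Data.List.Membership.Propositional using (lose)
open import Data.List.Membership.Propositional.Properties using (∈-allFin)
open import Data.List.Properties using (length-map; length-tabulate; map-tabulate; take-all)
open import Data.List.Relation.Unary.Any using (satisfied)
open import Data.List.Relation.Unary.Any.Properties using (any⁺; any⁻)
open import Data.Nat using (ℕ; zero; suc; _+_; _*_; _≤_; _<_; _∸_; z≤n; s≤s; s<s⁻¹)
open import Data.Nat.Properties
open import Algebra.Properties.CommutativeSemigroup +-commutativeSemigroup using (interchange)
open import Data.Product using (∃-syntax; Σ-syntax; _×_; _,_; proj₁; proj₂)
open import Data.Sum using (_⊎_; inj₁; inj₂)
open import Function.Bundles using (_⇔_; mk⇔; Equivalence)
open import Relation.Binary.Definitions using (tri<; tri≈; tri>)
open import Relation.Binary.PropositionalEquality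
open import Relation.Nullary using (¬_; Dec; does; yes; no)
open import Relation.Nullary.Decidable using (dec-true; dec-false)

bit : Bool → ℕ
bit true = 1
bit false = 0

bit≤1 : ∀ m → bit m ≤ 1
bit≤1 true = ≤-refl
bit≤1 false = z≤n

opening : Fin 2 → Step
opening fzero = U
opening (fsuc _) = D

rowOf : Step → Fin 2
rowOf U = fzero
rowOf red = fzero
rowOf D = fsuc fzero
rowOf blue = fsuc fzero

rowStep : Fin 2 → Bool → Step
rowStep fzero m = if m then U else red
rowStep (fsuc _) m = if m then D else blue

isOpening : Fin 2 → Step → Bool
isOpening r s = not (isHoriz s) ∧ does (rowOf s ≟F r)

-- isMinEntry S j with the box S j abstracted, so that a case split on S j can be transported.
noEarlierEntryIn : ∀ {b} → Filling b → Fin (2 * b + 1) → Box b → Bool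
noEarlierEntryIn {b} S j u = not (any (λ k → does (S k ≟B u) ∧ does (k <?F j)) (allFin (2 * b + 1)))

stepOf≡rowStep : ∀ {b} (S : Filling b) j → stepOf S j ≡ rowStep (proj₁ (S j)) (isMinEntry S j)
stepOf≡rowStep S j with S j in e
... | (fzero , _) = cong (λ u → if noEarlierEntryIn S j u then U else red) e
... | (fsuc _ , _) = cong (λ u → if noEarlierEntryIn S j u then D else blue) e

isOpening-rowStep : ∀ r r' m → isOpening r' (rowStep r m) ≡ m ∧ does (r ≟F r')
isOpening-rowStep fzero r' true = refl
isOpening-rowStep fzero r' false = refl
isOpening-rowStep (fsuc fzero) r' true = refl
isOpening-rowStep (fsuc fzero) r' false = refl

isOpening-opening : ∀ r → isOpening r (opening r) ≡ true
isOpening-opening fzero = refl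
isOpening-opening (fsuc fzero) = refl

isOpening⇒≡opening : ∀ r s → isOpening r s ≡ true → s ≡ opening r
isOpening⇒≡opening fzero U _ = refl
isOpening⇒≡opening (fsuc fzero) D _ = refl

rowOf-rowStep : ∀ r m → rowOf (rowStep r m) ≡ r
rowOf-rowStep fzero true = refl
rowOf-rowStep fzero false = refl
rowOf-rowStep (fsuc fzero) true = refl
rowOf-rowStep (fsuc fzero) false = refl

rowStep-rowOf : ∀ s → rowStep (rowOf s) (not (isHoriz s)) ≡ s
rowStep-rowOf U = refl
rowStep-rowOf D = refl
rowStep-rowOf red = refl
rowStep-rowOf blue = refl

rowStep≡⇒ : ∀ r m s → rowStep r m ≡ s → r ≡ rowOf s × m ≡ not (isHoriz s)
rowStep≡⇒ fzero true U refl = refl , refl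
rowStep≡⇒ fzero false red refl = refl , refl
rowStep≡⇒ (fsuc fzero) true D refl = refl , refl
rowStep≡⇒ (fsuc fzero) false blue refl = refl , refl

isHoriz-opening : ∀ r → isHoriz (opening r) ≡ false
isHoriz-opening fzero = refl
isHoriz-opening (fsuc _) = refl

≡opening-rowOf : ∀ s → isHoriz s ≡ false → s ≡ opening (rowOf s)
≡opening-rowOf U _ = refl
≡opening-rowOf D _ = refl

horizontal≢opening : ∀ r s → isHoriz s ≡ true → s ≢ opening r
horizontal≢opening r U ()
horizontal≢opening r D ()
horizontal≢opening fzero red _ ()
horizontal≢opening fzero blue _ ()
horizontal≢opening (fsuc _) red _ ()
horizontal≢opening (fsuc _) blue _ ()

rowOf-opening : ∀ r → rowOf (opening r) ≡ r
rowOf-opening fzero = refl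
rowOf-opening (fsuc fzero) = refl

-- Past the end of the path the default step is blue, which opens no box.
stepAt : List Step → ℕ → Step
stepAt [] _ = blue
stepAt (s ∷ p) zero = s
stepAt (s ∷ p) (suc j) = stepAt p j

openings : Fin 2 → List Step → ℕ → ℕ
openings r [] j = 0
openings r (s ∷ p) zero = 0
openings r (s ∷ p) (suc j) = bit (isOpening r s) + openings r p j

openings-zero : ∀ r p → openings r p 0 ≡ 0
openings-zero r [] = refl
openings-zero r (s ∷ p) = refl

openings-suc : ∀ r p j → openings r p (suc j) ≡ openings r p j + bit (isOpening r (stepAt p j))
openings-suc r [] j = refl
openings-suc r (s ∷ p) zero rewrite openings-zero r p = +-identityʳ _
openings-suc r (s ∷ p) (suc j) rewrite openings-suc r p j = sym (+-assoc (bit (isOpening r s)) _ _)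

openings-step : ∀ r p j → openings r p (suc j) ≤ suc (openings r p j)
openings-step r p j = begin
  openings r p (suc j)                         ≡⟨ openings-suc r p j ⟩
  openings r p j + bit (isOpening r (stepAt p j)) ≤⟨ +-monoʳ-≤ (openings r p j) (bit≤1 _) ⟩
  openings r p j + 1                           ≡⟨ +-comm (openings r p j) 1 ⟩
  suc (openings r p j)                         ∎
  where open ≤-Reasoning

openings-mono : ∀ r p {j k} → j ≤ k → openings r p j ≤ openings r p k
openings-mono r [] _ = z≤n
openings-mono r (s ∷ p) {zero} _ rewrite openings-zero r (s ∷ p) = z≤n
openings-mono r (s ∷ p) {suc j} {suc k} (s≤s j≤k) = +-monoʳ-≤ (bit (isOpening r s)) (openings-mono r p j≤k)

openings-reflects-< : ∀ r p {i j} → openings r p i < openings r p j → i < j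
openings-reflects-< r p N< = ≰⇒> (λ j≤i → <⇒≱ N< (openings-mono r p j≤i))

openings-hit : ∀ r p j → stepAt p j ≡ opening r → openings r p (suc j) ≡ suc (openings r p j)
openings-hit r p j e rewrite openings-suc r p j | e | isOpening-opening r = +-comm _ 1

openings-miss : ∀ r p j → stepAt p j ≢ opening r → openings r p (suc j) ≡ openings r p j
openings-miss r p j ne rewrite openings-suc r p j with isOpening r (stepAt p j) in e
... | true = ⊥-elim (ne (isOpening⇒≡opening r _ e))
... | false = +-identityʳ _

unit-steps-cross : (f : ℕ → ℕ) → f 0 ≡ 0 → (∀ j → f (suc j) ≤ suc (f j)) →
  ∀ {t} m → t < f m → ∃[ j ] (j < m × f j ≡ t × f (suc j) ≡ suc t)
unit-steps-cross f f0 step {t} zero t<f0 = ⊥-elim (n≮0 (subst (t <_) f0 t<f0))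
unit-steps-cross f f0 step {t} (suc m) t<fm+1 with t <? f m
... | yes t<fm = let (j , j<m , rest) = unit-steps-cross f f0 step m t<fm in j , m<n⇒m<1+n j<m , rest
... | no t≮fm = m , ≤-refl , fm≡t , ≤-antisym (≤-trans (step m) (s≤s (≤-reflexive fm≡t))) t<fm+1
  where
  fm≡t : f m ≡ t
  fm≡t = ≤-antisym (≮⇒≥ t≮fm) (≤-pred (≤-trans t<fm+1 (step m)))

openings-grows⇒opening : ∀ r p j → openings r p (suc j) ≡ suc (openings r p j) → stepAt p j ≡ opening r
openings-grows⇒opening r p j grows with isOpening r (stepAt p j) in e | openings-suc r p j
... | true | _ = isOpening⇒≡opening r _ e
... | false | N+0 = ⊥-elim (1+n≢n (trans (sym grows) (trans N+0 (+-identityʳ _))))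

nth-opening : ∀ r p {t} m → t < openings r p m →
  ∃[ j ] (j < m × openings r p j ≡ t × stepAt p j ≡ opening r)
nth-opening r p m t<N with unit-steps-cross (openings r p) (openings-zero r p) (openings-step r p) m t<N
... | (j , j<m , Nj≡t , Nj+1≡t+1) =
  j , j<m , Nj≡t , openings-grows⇒opening r p j (trans Nj+1≡t+1 (cong suc (sym Nj≡t)))

ups downs : List Step → ℕ → ℕ
ups = openings fzero
downs = openings (fsuc fzero)

height-take : ∀ p j → height (take j p) ≡ ups p j ⊖ downs p j
height-take [] zero = refl
height-take [] (suc j) = refl
height-take (s ∷ p) zero = refl
height-take (U ∷ p) (suc j) rewrite height-take p j = ℤ.distribʳ-⊖-+-pos 1 (ups p j) (downs p j)
height-take (D ∷ p) (suc j) rewrite height-take p j = ℤ.distribʳ-⊖-+-neg 0 (ups p j) (downs p j)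
height-take (red ∷ p) (suc j) rewrite height-take p j = ℤ.+-identityˡ _
height-take (blue ∷ p) (suc j) rewrite height-take p j = ℤ.+-identityˡ _

0≤m⊖n⇒n≤m : ∀ m n → 0ℤ ≤ℤ m ⊖ n → n ≤ m
0≤m⊖n⇒n≤m m zero _ = z≤n
0≤m⊖n⇒n≤m (suc m) (suc n) 0≤ = s≤s (0≤m⊖n⇒n≤m m n (subst (0ℤ ≤ℤ_) (ℤ.[1+m]⊖[1+n]≡m⊖n m n) 0≤))

n≤m⇒0≤m⊖n : ∀ {m n} → n ≤ m → 0ℤ ≤ℤ m ⊖ n
n≤m⇒0≤m⊖n n≤m rewrite ℤ.⊖-≥ n≤m = +≤+ z≤n

m⊖n≡0⇒m≡n : ∀ m n → m ⊖ n ≡ 0ℤ → m ≡ n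
m⊖n≡0⇒m≡n zero zero _ = refl
m⊖n≡0⇒m≡n (suc m) (suc n) e = cong suc (m⊖n≡0⇒m≡n m n (trans (sym (ℤ.[1+m]⊖[1+n]≡m⊖n m n)) e))

horizontals : List Step → ℕ
horizontals p = length (filter isHorizDec p)

horizontals+openings : ∀ p →
  horizontals p + (ups p (length p) + downs p (length p)) ≡ length p
horizontals+openings [] = refl
horizontals+openings (U ∷ p) = trans (+-suc _ _) (cong suc (horizontals+openings p))
horizontals+openings (D ∷ p) =
  trans (cong (λ n → horizontals p + n) (+-suc _ _)) (trans (+-suc _ _) (cong suc (horizontals+openings p)))
horizontals+openings (red ∷ p) = cong suc (horizontals+openings p)
horizontals+openings (blue ∷ p) = cong suc (horizontals+openings p)

no-horizontal : ∀ p → horizontals p ≡ 0 → ∀ j → j < length p → ¬ isHoriz (stepAt p j) ≡ true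
no-horizontal (U ∷ p) none zero _ ()
no-horizontal (D ∷ p) none zero _ ()
no-horizontal (U ∷ p) none (suc j) (s≤s j<) = no-horizontal p none j j<
no-horizontal (D ∷ p) none (suc j) (s≤s j<) = no-horizontal p none j j<

UniqueHorizontal : List Step → Set
UniqueHorizontal p =
  ∃[ h ] (h < length p × isHoriz (stepAt p h) ≡ true ×
          (∀ j → j < length p → isHoriz (stepAt p j) ≡ true → j ≡ h))

horizontal-first : ∀ s p → isHoriz s ≡ true → horizontals p ≡ 0 → UniqueHorizontal (s ∷ p)
horizontal-first s p hs none = 0 , s≤s z≤n , hs , λ
  { zero _ _ → refl
  ; (suc j) (s≤s j<) jh → ⊥-elim (no-horizontal p none j j< jh) }

horizontal-later : ∀ s p → isHoriz s ≡ false → UniqueHorizontal p → UniqueHorizontal (s ∷ p)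
horizontal-later s p notHoriz (h , h< , hh , only) = suc h , s≤s h< , hh , λ
  { zero _ horiz → ⊥-elim (not-¬ horiz notHoriz)
  ; (suc j) (s≤s j<) jh → cong suc (only j j< jh) }

unique-horizontal : ∀ p → horizontals p ≡ 1 → UniqueHorizontal p
unique-horizontal (U ∷ p) one = horizontal-later U p refl (unique-horizontal p one)
unique-horizontal (D ∷ p) one = horizontal-later D p refl (unique-horizontal p one)
unique-horizontal (red ∷ p) one = horizontal-first red p refl (suc-injective one)
unique-horizontal (blue ∷ p) one = horizontal-first blue p refl (suc-injective one)

∧≡true⇒ : ∀ x y → x ∧ y ≡ true → x ≡ true × y ≡ true
∧≡true⇒ true true _ = refl , refl

does≡true⇒ : ∀ {P : Set} (P? : Dec P) → does P? ≡ true → P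
does≡true⇒ (yes p) _ = p

countFin : ∀ n → (Fin n → Bool) → ℕ
countFin zero f = 0
countFin (suc n) f = bit (f fzero) + countFin n (λ j → f (fsuc j))

length-filter-tabulate : ∀ {A : Set} {n} {P : A → Set} (P? : ∀ x → Dec (P x)) (g : Fin n → A) →
  length (filter P? (tabulate g)) ≡ countFin n (λ j → does (P? (g j)))
length-filter-tabulate {n = zero} P? g = refl
length-filter-tabulate {n = suc n} P? g with does (P? (g fzero))
... | true = cong suc (length-filter-tabulate P? (λ j → g (fsuc j)))
... | false = length-filter-tabulate P? (λ j → g (fsuc j))

bit-split : ∀ m q → bit m ≡ bit (m ∧ q) + bit (m ∧ not q)
bit-split true true = refl
bit-split true false = refl
bit-split false q = refl

countFin-split : ∀ n (f q : Fin n → Bool) →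
  countFin n f ≡ countFin n (λ j → f j ∧ q j) + countFin n (λ j → f j ∧ not (q j))
countFin-split zero f q = refl
countFin-split (suc n) f q =
  trans (cong₂ _+_ (bit-split (f fzero) (q fzero)) (countFin-split n (λ j → f (fsuc j)) (λ j → q (fsuc j))))
        (interchange (bit (f fzero ∧ q fzero)) _ _ _)

countFin-none : ∀ n (f : Fin n → Bool) → (∀ j → ¬ f j ≡ true) → countFin n f ≡ 0
countFin-none zero f none = refl
countFin-none (suc n) f none rewrite ¬-not (none fzero) = countFin-none n _ (λ j → none (fsuc j))

countFin-unique : ∀ n (f : Fin n → Bool) a → (∀ j → f j ≡ true → j ≡ a) → countFin n f ≡ bit (f a)
countFin-unique (suc n) f fzero only =
  trans (cong (bit (f fzero) +_) (countFin-none n _ (λ j fj → 0≢1+n (cong toℕ (sym (only (fsuc j) fj)))))) (+-identityʳ _)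
countFin-unique (suc n) f (fsuc a) only rewrite ¬-not {f fzero} (λ f0 → 0≢1+n (cong toℕ (only fzero f0))) =
  countFin-unique n _ a (λ j fj → fsuc-injective (only (fsuc j) fj))

T-does-∧ : ∀ {P Q : Set} (p? : Dec P) (q? : Dec Q) → T (does p? ∧ does q?) ⇔ (P × Q)
T-does-∧ (yes p) (yes q) = mk⇔ (λ _ → p , q) _
T-does-∧ (yes _) (no ¬q) = mk⇔ (λ ()) (λ (_ , q) → ¬q q)
T-does-∧ (no ¬p) _ = mk⇔ (λ ()) (λ (p , _) → ¬p p)

module _ {b : ℕ} (S : Filling b) (j : Fin (2 * b + 1)) where

  EarlierInBox : Set
  EarlierInBox = ∃[ k ] (S k ≡ S j × toℕ k < toℕ j)

  isMinEntry≡false⇔ : isMinEntry S j ≡ false ⇔ EarlierInBox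
  isMinEntry≡false⇔ = mk⇔ to from
    where
    earlier? : Fin (2 * b + 1) → Bool
    earlier? k = does (S k ≟B S j) ∧ does (k <?F j)

    to : isMinEntry S j ≡ false → EarlierInBox
    to e with satisfied (any⁻ earlier? (allFin _) (Equivalence.from T-≡ (not-injective {y = true} e)))
    ... | (k , hit) = k , Equivalence.to (T-does-∧ (S k ≟B S j) (k <?F j)) hit

    from : EarlierInBox → isMinEntry S j ≡ false
    from (k , same , before) =
      cong not (Equivalence.to T-≡ (any⁺ earlier? (lose (∈-allFin k)
        (Equivalence.from (T-does-∧ (S k ≟B S j) (k <?F j)) (same , before)))))

  isMinEntry≡true⇔ : isMinEntry S j ≡ true ⇔ (¬ EarlierInBox)
  isMinEntry≡true⇔ = mk⇔ to from
    where
    to : isMinEntry S j ≡ true → ¬ EarlierInBox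
    to e earlier with trans (sym e) (Equivalence.from isMinEntry≡false⇔ earlier)
    ... | ()

    from : ¬ EarlierInBox → isMinEntry S j ≡ true
    from none with isMinEntry S j in e
    ... | true = refl
    ... | false = ⊥-elim (none (Equivalence.to isMinEntry≡false⇔ e))

stepAt-lookup : ∀ p (i : Fin (length p)) → lookup p i ≡ stepAt p (toℕ i)
stepAt-lookup (s ∷ p) fzero = refl
stepAt-lookup (s ∷ p) (fsuc i) = stepAt-lookup p i

stepAt-tabulate : ∀ {n} (g : Fin n → Step) (j : Fin n) → stepAt (tabulate g) (toℕ j) ≡ g j
stepAt-tabulate g fzero = refl
stepAt-tabulate g (fsuc j) = stepAt-tabulate (λ k → g (fsuc k)) j

stepAt-Γ : ∀ {b} (S : Filling b) j → stepAt (Γ S) (toℕ j) ≡ rowStep (proj₁ (S j)) (isMinEntry S j)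
stepAt-Γ S j rewrite map-tabulate (λ k → k) (stepOf S) = trans (stepAt-tabulate (stepOf S) j) (stepOf≡rowStep S j)

length-Γ : ∀ {b} (S : Filling b) → length (Γ S) ≡ 2 * b + 1
length-Γ {b} S = trans (length-map (stepOf S) (allFin _)) (length-tabulate {n = 2 * b + 1} (λ k → k))

stepAt-injective : ∀ p q → length p ≡ length q → (∀ k → k < length p → stepAt p k ≡ stepAt q k) → p ≡ q
stepAt-injective [] [] _ _ = refl
stepAt-injective (s ∷ p) (s′ ∷ q) len same =
  cong₂ _∷_ (same 0 (s≤s z≤n)) (stepAt-injective p q (suc-injective len) (λ k k< → same (suc k) (s≤s k<)))

2*n+1≡1+[n+n] : ∀ n → 2 * n + 1 ≡ suc (n + n)
2*n+1≡1+[n+n] n = trans (+-comm (2 * n) 1) (cong (λ m → suc (n + m)) (+-identityʳ n))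

record RBMotzCounts (b : ℕ) (p : List Step) : Set where
  field
    length≡ : length p ≡ 2 * b + 1
    downs≤ups : ∀ i → i ≤ 2 * b + 1 → downs p i ≤ ups p i
    total : ∀ r → openings r p (2 * b + 1) ≡ b
    red-above-axis : ∀ j → j < 2 * b + 1 → stepAt p j ≡ red → downs p j < ups p j
    blue-after-down : ∀ j → j < 2 * b + 1 → stepAt p j ≡ blue → 0 < downs p j

  total-length : ∀ r → openings r p (length p) ≡ b
  total-length r = trans (cong (openings r p) length≡) (total r)

module _ {b : ℕ} {p : List Step} where

  counts⇒horizontals≡1 : RBMotzCounts b p → horizontals p ≡ 1
  counts⇒horizontals≡1 C = +-cancelʳ-≡ (b + b) (horizontals p) 1 (begin
    horizontals p + (b + b)  ≡⟨ cong₂ (λ u d → horizontals p + (u + d)) (sym (total-length fzero)) (sym (total-length (fsuc fzero))) ⟩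
    horizontals p + (ups p (length p) + downs p (length p)) ≡⟨ horizontals+openings p ⟩
    length p                 ≡⟨ length≡ ⟩
    2 * b + 1                ≡⟨ 2*n+1≡1+[n+n] b ⟩
    1 + (b + b)              ∎)
    where
    open ≡-Reasoning
    open RBMotzCounts C

  counts⇒RBMotz : RBMotzCounts b p → RBMotz (2 * b + 1) 1 p
  counts⇒RBMotz C = length≡ , nonnegative , ends-on-axis , red-off-axis , blue-late , counts⇒horizontals≡1 C
    where
    open RBMotzCounts C

    index : ∀ i → i < length p → i < 2 * b + 1
    index i i< = subst (i <_) length≡ i<

    nonnegative : ∀ i → i ≤ length p → 0ℤ ≤ℤ height (take i p)
    nonnegative i i≤ rewrite height-take p i = n≤m⇒0≤m⊖n (downs≤ups i (subst (i ≤_) length≡ i≤))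

    ends-on-axis : height p ≡ 0ℤ
    ends-on-axis = begin
      height p                                                    ≡⟨ cong height (sym (take-all (length p) p ≤-refl)) ⟩
      height (take (length p) p)                                  ≡⟨ height-take p (length p) ⟩
      ups p (length p) ⊖ downs p (length p) ≡⟨ cong₂ _⊖_ (total-length fzero) (total-length (fsuc fzero)) ⟩
      b ⊖ b                                                       ≡⟨ ℤ.n⊖n≡0 b ⟩
      0ℤ                                                          ∎
      where open ≡-Reasoning

    red-off-axis : ∀ (i : Fin (length p)) → lookup p i ≡ red → height (take (toℕ i) p) ≢ 0ℤ
    red-off-axis i isRed onAxis =
      <-irrefl (sym (m⊖n≡0⇒m≡n _ _ (trans (sym (height-take p (toℕ i))) onAxis)))
               (red-above-axis (toℕ i) (index _ (toℕ<n i)) (trans (sym (stepAt-lookup p i)) isRed))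

    blue-late : ∀ (i : Fin (length p)) → lookup p i ≡ blue → ∃[ j ] ((toℕ j < toℕ i) × (lookup p j ≡ D))
    blue-late i isBlue
      with nth-opening (fsuc fzero) p (toℕ i)
             (blue-after-down (toℕ i) (index _ (toℕ<n i)) (trans (sym (stepAt-lookup p i)) isBlue))
    ... | (j , j<i , _ , isD) =
      fromℕ< j<len , subst (_< toℕ i) (sym (toℕ-fromℕ< j<len)) j<i ,
      trans (stepAt-lookup p _) (trans (cong (stepAt p) (toℕ-fromℕ< j<len)) isD)
      where
      j<len : j < length p
      j<len = <-trans j<i (toℕ<n i)


  RBMotz⇒counts : RBMotz (2 * b + 1) 1 p → RBMotzCounts b p
  RBMotz⇒counts (len , nonnegative , ends-on-axis , red-off-axis , blue-late , one-horizontal) = record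
    { length≡ = len
    ; downs≤ups = downs≤ups
    ; total = total
    ; red-above-axis = red-above-axis
    ; blue-after-down = blue-after-down
    }
    where
    index : ∀ j → j < 2 * b + 1 → Fin (length p)
    index j j< = fromℕ< (subst (j <_) (sym len) j<)

    toℕ-index : ∀ j j< → toℕ (index j j<) ≡ j
    toℕ-index j j< = toℕ-fromℕ< _

    stepAt-index : ∀ j j< → lookup p (index j j<) ≡ stepAt p j
    stepAt-index j j< = trans (stepAt-lookup p _) (cong (stepAt p) (toℕ-index j j<))

    downs≤ups : ∀ i → i ≤ 2 * b + 1 → downs p i ≤ ups p i
    downs≤ups i i≤ =
      0≤m⊖n⇒n≤m _ _ (subst (0ℤ ≤ℤ_) (height-take p i) (nonnegative i (subst (i ≤_) (sym len) i≤)))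

    balancedAt-length : ups p (length p) ≡ downs p (length p)
    balancedAt-length = m⊖n≡0⇒m≡n _ _ (begin
      ups p (length p) ⊖ downs p (length p) ≡⟨ sym (height-take p (length p)) ⟩
      height (take (length p) p)                                       ≡⟨ cong height (take-all (length p) p ≤-refl) ⟩
      height p                                                         ≡⟨ ends-on-axis ⟩
      0ℤ                                                               ∎)
      where open ≡-Reasoning

    downsAt-length : downs p (length p) ≡ b
    downsAt-length = *-cancelˡ-≡ d b 2 (suc-injective (begin
      suc (2 * d)                                ≡⟨ cong (λ n → suc (d + n)) (+-identityʳ d) ⟩
      1 + (d + d)                            ≡⟨ cong₂ (λ h n → h + (n + d)) (sym one-horizontal) (sym balancedAt-length) ⟩
      horizontals p + (ups p (length p) + d) ≡⟨ horizontals+openings p ⟩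
      length p                                       ≡⟨ len ⟩
      2 * b + 1                                      ≡⟨ +-comm (2 * b) 1 ⟩
      suc (2 * b)                                    ∎))
      where
      open ≡-Reasoning
      d = downs p (length p)

    total : ∀ r → openings r p (2 * b + 1) ≡ b
    total fzero = subst (λ n → ups p n ≡ b) len (trans balancedAt-length downsAt-length)
    total (fsuc fzero) = subst (λ n → downs p n ≡ b) len downsAt-length

    red-above-axis : ∀ j → j < 2 * b + 1 → stepAt p j ≡ red → downs p j < ups p j
    red-above-axis j j< isRed with m≤n⇒m<n∨m≡n (downs≤ups j (<⇒≤ j<))
    ... | inj₁ below = below
    ... | inj₂ level = ⊥-elim (red-off-axis (index j j<) (trans (stepAt-index j j<) isRed) (begin
      height (take (toℕ (index j j<)) p)                   ≡⟨ cong (λ i → height (take i p)) (toℕ-index j j<) ⟩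
      height (take j p)                                   ≡⟨ height-take p j ⟩
      ups p j ⊖ downs p j      ≡⟨ cong (ups p j ⊖_) level ⟩
      ups p j ⊖ ups p j             ≡⟨ ℤ.n⊖n≡0 (ups p j) ⟩
      0ℤ                                                  ∎))
      where open ≡-Reasoning

    blue-after-down : ∀ j → j < 2 * b + 1 → stepAt p j ≡ blue → 0 < downs p j
    blue-after-down j j< isBlue with blue-late (index j j<) (trans (stepAt-index j j<) isBlue)
    ... | (k , k<j , isD) =
      <-≤-trans (subst (0 <_) (sym (openings-hit (fsuc fzero) p (toℕ k) (trans (sym (stepAt-lookup p k)) isD))) (s≤s z≤n))
                (openings-mono (fsuc fzero) p (subst (suc (toℕ k) ≤_) (toℕ-fromℕ< _) k<j))

column-≢ : ∀ {b} {r r' : Fin 2} {c c' : Fin b} → toℕ c ≢ toℕ c' → (r , c) ≢ (r' , c')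
column-≢ c≢c' eq = c≢c' (cong (λ u → toℕ (proj₂ u)) eq)

module Tableau {b : ℕ} (S : Filling b)
  (nonempty : ∀ (u : Box b) → ∃[ j ] (S j ≡ u))
  (ordered : ∀ (u v : Box b) → u ≢ v → u ≼ v → ∀ i j → S i ≡ u → S j ≡ v → toℕ i < toℕ j) where

  opened : Fin 2 → ℕ → ℕ
  opened r = openings r (Γ S)

  opened-suc : ∀ r J →
    opened r (suc (toℕ J)) ≡ opened r (toℕ J) + bit (isMinEntry S J ∧ does (proj₁ (S J) ≟F r))
  opened-suc r J = begin
    opened r (suc (toℕ J))
      ≡⟨ openings-suc r (Γ S) (toℕ J) ⟩
    opened r (toℕ J) + bit (isOpening r (stepAt (Γ S) (toℕ J)))
      ≡⟨ cong (λ s → opened r (toℕ J) + bit (isOpening r s)) (stepAt-Γ S J) ⟩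
    opened r (toℕ J) + bit (isOpening r (rowStep (proj₁ (S J)) (isMinEntry S J)))
      ≡⟨ cong (λ m → opened r (toℕ J) + bit m) (isOpening-rowStep (proj₁ (S J)) r (isMinEntry S J)) ⟩
    opened r (toℕ J) + bit (isMinEntry S J ∧ does (proj₁ (S J) ≟F r))
      ∎
    where open ≡-Reasoning

  record FilledUpTo (j : ℕ) : Set where
    field
      column< : ∀ r c k → toℕ k < j → S k ≡ (r , c) → toℕ c < opened r j
      filled : ∀ r c → toℕ c < opened r j → ∃[ k ] (toℕ k < j × S k ≡ (r , c))
      opened≤ : ∀ r → opened r j ≤ b

  filledUpTo-zero : FilledUpTo 0
  filledUpTo-zero = record
    { column< = λ _ _ _ ()
    ; filled = λ r c c< → ⊥-elim (n≮0 (subst (toℕ c <_) (openings-zero r (Γ S)) c<))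
    ; opened≤ = λ r → subst (_≤ b) (sym (openings-zero r (Γ S))) z≤n
    }

  module Extend (J : Fin (2 * b + 1)) (I : FilledUpTo (toℕ J)) where
    open FilledUpTo I

    j = toℕ J
    r₀ = proj₁ (S J)
    c₀ = proj₂ (S J)

    column-nonminimal : isMinEntry S J ≡ false → toℕ c₀ < opened r₀ j
    column-nonminimal notMin with Equivalence.to (isMinEntry≡false⇔ S J) notMin
    ... | (k , same , k<j) = column< r₀ c₀ k k<j same

    column-minimal : isMinEntry S J ≡ true → toℕ c₀ ≡ opened r₀ j
    column-minimal isMin with <-cmp (toℕ c₀) (opened r₀ j)
    ... | tri< c₀< _ _ = let (k , k<j , same) = filled r₀ c₀ c₀< in
                         ⊥-elim (Equivalence.to (isMinEntry≡true⇔ S J) isMin (k , same , k<j))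
    ... | tri≈ _ c₀≡ _ = c₀≡
    ... | tri> _ _ c₀> = ⊥-elim (unfilled-gap (nonempty (r₀ , gap)))
      where
      opened<b : opened r₀ j < b
      opened<b = <-trans c₀> (toℕ<n c₀)
      gap : Fin b
      gap = fromℕ< opened<b
      -- The first unopened box of row r₀ lies strictly west of S J, so it is filled before J.
      unfilled-gap : ∃[ k ] (S k ≡ (r₀ , gap)) → ⊥
      unfilled-gap (k , inGap) with toℕ k <? j
      ... | yes k<j = <-irrefl (toℕ-fromℕ< opened<b) (column< r₀ gap k k<j inGap)
      ... | no k≮j = k≮j (ordered (r₀ , gap) (S J)
              (column-≢ (λ e → <-irrefl (trans (sym (toℕ-fromℕ< opened<b)) e) c₀>))
              (≤-refl , ≤-trans (≤-reflexive (toℕ-fromℕ< opened<b)) (<⇒≤ c₀>)) k J inGap refl)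

    opened-minimal : isMinEntry S J ≡ true → opened r₀ (suc j) ≡ suc (opened r₀ j)
    opened-minimal isMin rewrite opened-suc r₀ J | isMin | dec-true (r₀ ≟F r₀) refl = +-comm _ 1

    opened-unchanged : ∀ r → r₀ ≢ r ⊎ isMinEntry S J ≡ false → opened r (suc j) ≡ opened r j
    opened-unchanged r (inj₁ r₀≢r)
      rewrite opened-suc r J | dec-false (r₀ ≟F r) r₀≢r | ∧-zeroʳ (isMinEntry S J) = +-identityʳ _
    opened-unchanged r (inj₂ notMin) rewrite opened-suc r J | notMin = +-identityʳ _

    column<-self : toℕ c₀ < opened r₀ (suc j)
    column<-self with isMinEntry S J in isMin
    ... | true = subst (toℕ c₀ <_) (sym (opened-minimal isMin)) (s≤s (≤-reflexive (column-minimal isMin)))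
    ... | false = subst (toℕ c₀ <_) (sym (opened-unchanged r₀ (inj₂ isMin))) (column-nonminimal isMin)

    earlier : ∀ {r c} → ∃[ k ] (toℕ k < j × S k ≡ (r , c)) → ∃[ k ] (toℕ k < suc j × S k ≡ (r , c))
    earlier (k , k<j , inBox) = k , m<n⇒m<1+n k<j , inBox

    filled-suc : ∀ r c → toℕ c < opened r (suc j) → ∃[ k ] (toℕ k < suc j × S k ≡ (r , c))
    filled-suc r c c< with isMinEntry S J in isMin | r₀ ≟F r
    ... | false | _ = earlier (filled r c (subst (toℕ c <_) (opened-unchanged r (inj₂ isMin)) c<))
    ... | true | no r₀≢r = earlier (filled r c (subst (toℕ c <_) (opened-unchanged r (inj₁ r₀≢r)) c<))
    ... | true | yes refl with m≤n⇒m<n∨m≡n (≤-pred (subst (toℕ c <_) (opened-minimal isMin) c<))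
    ...   | inj₁ c<opened = earlier (filled r c c<opened)
    ...   | inj₂ c≡opened = J , ≤-refl , cong (r₀ ,_) (toℕ-injective (trans (column-minimal isMin) (sym c≡opened)))

    opened≤-suc : ∀ r → opened r (suc j) ≤ b
    opened≤-suc r with isMinEntry S J in isMin | r₀ ≟F r
    ... | false | _ rewrite opened-unchanged r (inj₂ isMin) = opened≤ r
    ... | true | no r₀≢r rewrite opened-unchanged r (inj₁ r₀≢r) = opened≤ r
    ... | true | yes refl rewrite opened-minimal isMin | sym (column-minimal isMin) = toℕ<n c₀

    filledUpTo-suc : FilledUpTo (suc j)
    filledUpTo-suc = record
      { column< = column<-suc
      ; filled = filled-suc
      ; opened≤ = opened≤-suc
      }
      where
      column<-suc : ∀ r c k → toℕ k < suc j → S k ≡ (r , c) → toℕ c < opened r (suc j)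
      column<-suc r c k k≤j inBox with m≤n⇒m<n∨m≡n (≤-pred k≤j)
      ... | inj₁ k<j = <-≤-trans (column< r c k k<j inBox) (openings-mono r (Γ S) (n≤1+n j))
      ... | inj₂ k≡j with toℕ-injective k≡j
      ...   | refl = subst (λ u → toℕ (proj₂ u) < opened (proj₁ u) (suc j)) inBox column<-self

  filledUpTo : ∀ j → j ≤ 2 * b + 1 → FilledUpTo j
  filledUpTo zero _ = filledUpTo-zero
  filledUpTo (suc j) j< =
    subst (λ i → FilledUpTo (suc i)) (toℕ-fromℕ< j<)
      (Extend.filledUpTo-suc (fromℕ< j<) (subst FilledUpTo (sym (toℕ-fromℕ< j<)) (filledUpTo j (<⇒≤ j<))))

  opened-total : ∀ r → opened r (2 * b + 1) ≡ b
  opened-total r = ≤-antisym (opened≤ r) (≮⇒≥ unopened-box)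
    where
    open FilledUpTo (filledUpTo (2 * b + 1) ≤-refl)
    unopened-box : ¬ opened r (2 * b + 1) < b
    unopened-box opened<b with nonempty (r , fromℕ< opened<b)
    ... | (k , inBox) = <-irrefl (toℕ-fromℕ< opened<b) (column< r _ k (toℕ<n k) inBox)

  opened≡1+column : ∀ j → opened (proj₁ (S j)) (suc (toℕ j)) ≡ suc (toℕ (proj₂ (S j)))
  opened≡1+column j = ≤-antisym (≮⇒≥ next-box-unfilled) (column< r c j ≤-refl refl)
    where
    open FilledUpTo (filledUpTo (suc (toℕ j)) (toℕ<n j))
    r = proj₁ (S j)
    c = proj₂ (S j)
    next-box-unfilled : ¬ suc (toℕ c) < opened r (suc (toℕ j))
    next-box-unfilled c+1< = <⇒≱ j<k (≤-pred (proj₁ (proj₂ entry)))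
      where
      next< : suc (toℕ c) < b
      next< = <-≤-trans c+1< (opened≤ r)
      next≡ : toℕ (fromℕ< next<) ≡ suc (toℕ c)
      next≡ = toℕ-fromℕ< next<
      entry : ∃[ k ] (toℕ k < suc (toℕ j) × S k ≡ (r , fromℕ< next<))
      entry = filled r (fromℕ< next<) (subst (_< opened r (suc (toℕ j))) (sym next≡) c+1<)
      j<k : toℕ j < toℕ (proj₁ entry)
      j<k = ordered (S j) (r , fromℕ< next<) (column-≢ (λ e → 1+n≢n (sym (trans e next≡))))
              (≤-refl , ≤-trans (n≤1+n _) (≤-reflexive (sym next≡))) j (proj₁ entry) refl (proj₂ (proj₂ entry))

  downs≤ups : ∀ i → i ≤ 2 * b + 1 → opened (fsuc fzero) i ≤ opened fzero i
  downs≤ups i i≤ with opened (fsuc fzero) i in opened≡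
  ... | zero = z≤n
  ... | suc m = subst (_< opened fzero i) (toℕ-fromℕ< m<b) (column< fzero col k′ k′<i inTop)
    where
    open FilledUpTo (filledUpTo i i≤)
    m<b : m < b
    m<b = subst (_≤ b) opened≡ (opened≤ (fsuc fzero))
    col : Fin b
    col = fromℕ< m<b
    bottom : ∃[ k ] (toℕ k < i × S k ≡ (fsuc fzero , col))
    bottom = filled (fsuc fzero) col (subst (toℕ col <_) (sym opened≡) (s≤s (≤-reflexive (toℕ-fromℕ< m<b))))
    k′ = proj₁ (nonempty (fzero , col))
    inTop = proj₂ (nonempty (fzero , col))
    k′<i : toℕ k′ < i
    k′<i = <-trans
      (ordered (fzero , col) (fsuc fzero , col) (λ ()) (z≤n , ≤-refl) k′ (proj₁ bottom) inTop (proj₂ (proj₂ bottom)))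
      (proj₁ (proj₂ bottom))

  nonminimal-top⇒above-axis : ∀ J → proj₁ (S J) ≡ fzero → isMinEntry S J ≡ false →
                   opened (fsuc fzero) (toℕ J) < opened fzero (toℕ J)
  nonminimal-top⇒above-axis J top notMin =
    ≤-<-trans (≮⇒≥ bottom-unopened)
      (subst (λ r → toℕ (proj₂ (S J)) < opened r (toℕ J)) top (Extend.column-nonminimal J I notMin))
    where
    I = filledUpTo (toℕ J) (<⇒≤ (toℕ<n J))
    open FilledUpTo I
    bottom-unopened : ¬ toℕ (proj₂ (S J)) < opened (fsuc fzero) (toℕ J)
    bottom-unopened c< with filled (fsuc fzero) (proj₂ (S J)) c<
    ... | (k , k<J , below) = <-asym k<J (ordered (S J) (fsuc fzero , proj₂ (S J))
           (λ e → 0≢1+n (trans (cong toℕ (sym top)) (cong (λ u → toℕ (proj₁ u)) e)))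
           (subst (λ r → toℕ r ≤ 1) (sym top) z≤n , ≤-refl) J k refl below)

  nonminimal⇒row-opened : ∀ J → isMinEntry S J ≡ false → 0 < opened (proj₁ (S J)) (toℕ J)
  nonminimal⇒row-opened J notMin =
    ≤-<-trans z≤n (Extend.column-nonminimal J (filledUpTo (toℕ J) (<⇒≤ (toℕ<n J))) notMin)

  Γ-counts : RBMotzCounts b (Γ S)
  Γ-counts = record
    { length≡ = length-Γ S
    ; downs≤ups = downs≤ups
    ; total = opened-total
    ; red-above-axis = λ j j< isRed → let (top , notMin) = decodeStep j j< isRed in
        subst (λ i → opened (fsuc fzero) i < opened fzero i) (toℕ-fromℕ< j<)
          (nonminimal-top⇒above-axis (fromℕ< j<) top notMin)
    ; blue-after-down = λ j j< isBlue → let (bottom , notMin) = decodeStep j j< isBlue in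
        subst (λ i → 0 < opened (fsuc fzero) i) (toℕ-fromℕ< j<)
          (subst (λ r → 0 < opened r (toℕ (fromℕ< j<))) bottom (nonminimal⇒row-opened (fromℕ< j<) notMin))
    }
    where
    decodeStep : ∀ j (j< : j < 2 * b + 1) {s} → stepAt (Γ S) j ≡ s →
                 proj₁ (S (fromℕ< j<)) ≡ rowOf s × isMinEntry S (fromℕ< j<) ≡ not (isHoriz s)
    decodeStep j j< isS =
      rowStep≡⇒ _ _ _ (trans (sym (stepAt-Γ S (fromℕ< j<))) (trans (cong (stepAt (Γ S)) (toℕ-fromℕ< j<)) isS))

clamp : ∀ n → ℕ → Fin (suc n)
clamp zero m = fzero
clamp (suc n) zero = fzero
clamp (suc n) (suc m) = fsuc (clamp n m)

toℕ-clamp : ∀ n m → m ≤ n → toℕ (clamp n m) ≡ m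
toℕ-clamp zero zero z≤n = refl
toℕ-clamp (suc n) zero _ = refl
toℕ-clamp (suc n) (suc m) (s≤s m≤n) = cong suc (toℕ-clamp n m m≤n)

-- The inverse of Γ. On paths satisfying RBMotzCounts the count is between 1 and b′ + 1,
-- so neither the truncated subtraction nor the clamp ever cuts anything off.
boxAt : (b′ : ℕ) → List Step → ℕ → Box (suc b′)
boxAt b′ p j = rowOf (stepAt p j) , clamp b′ (openings (rowOf (stepAt p j)) p (suc j) ∸ 1)

decode : (b′ : ℕ) → List Step → Filling (suc b′)
decode b′ p j = boxAt b′ p (toℕ j)

boxAt≡ : ∀ b′ p j {r c} → rowOf (stepAt p j) ≡ r → openings r p (suc j) ≡ suc (toℕ c) → boxAt b′ p j ≡ (r , c)
boxAt≡ b′ p j {c = c} refl rank≡ =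
  cong (rowOf (stepAt p j) ,_) (toℕ-injective (trans (cong (λ m → toℕ (clamp b′ (m ∸ 1))) rank≡)
                                                     (toℕ-clamp b′ (toℕ c) (≤-pred (toℕ<n c)))))

decode-Γ : ∀ b′ (S : Filling (suc b′)) → IsSYT+1 S → ∀ j → decode b′ (Γ S) j ≡ S j
decode-Γ b′ S (nonempty , _ , ordered) j =
  boxAt≡ b′ (Γ S) (toℕ j) (trans (cong rowOf (stepAt-Γ S j)) (rowOf-rowStep _ _))
    (Tableau.opened≡1+column S nonempty ordered j)

module Decode (b′ : ℕ) (p : List Step) (C : RBMotzCounts (suc b′) p) where
  open RBMotzCounts C

  n = 2 * suc b′ + 1

  Φ : Filling (suc b′)
  Φ = decode b′ p

  row-opened : ∀ j → j < n → 0 < openings (rowOf (stepAt p j)) p (suc j)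
  row-opened j j< with stepAt p j in step
  ... | U = subst (0 <_) (sym (openings-hit fzero p j step)) (s≤s z≤n)
  ... | D = subst (0 <_) (sym (openings-hit (fsuc fzero) p j step)) (s≤s z≤n)
  ... | red = <-≤-trans (≤-<-trans z≤n (red-above-axis j j< step)) (openings-mono fzero p (n≤1+n j))
  ... | blue = <-≤-trans (blue-after-down j j< step) (openings-mono (fsuc fzero) p (n≤1+n j))

  boxAt≡⇒ : ∀ j → j < n → ∀ {r c} → boxAt b′ p j ≡ (r , c) →
            rowOf (stepAt p j) ≡ r × openings r p (suc j) ≡ suc (toℕ c)
  boxAt≡⇒ j j< refl = refl , (begin
    rank              ≡⟨ sym (m∸n+n≡m (row-opened j j<)) ⟩
    rank ∸ 1 + 1      ≡⟨ +-comm (rank ∸ 1) 1 ⟩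
    suc (rank ∸ 1)    ≡⟨ cong suc (sym (toℕ-clamp b′ (rank ∸ 1) (∸-monoˡ-≤ 1 rank≤))) ⟩
    suc (toℕ (clamp b′ (rank ∸ 1))) ∎)
    where
    open ≡-Reasoning
    rank = openings (rowOf (stepAt p j)) p (suc j)
    rank≤ : rank ≤ suc b′
    rank≤ = ≤-trans (openings-mono _ p j<) (≤-reflexive (total _))

  opening-first : ∀ (K k : Fin n) → isHoriz (stepAt p (toℕ K)) ≡ false → Φ k ≡ Φ K → ¬ toℕ k < toℕ K
  opening-first K k notHoriz sameBox k<K = <⇒≱ (≤-reflexive (sym rank≡)) (openings-mono r p k<K)
    where
    r = rowOf (stepAt p (toℕ K))
    rankK : openings r p (suc (toℕ K)) ≡ suc (openings r p (toℕ K))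
    rankK = openings-hit r p (toℕ K) (≡opening-rowOf _ notHoriz)
    rank≡ : openings r p (suc (toℕ k)) ≡ suc (openings r p (toℕ K))
    rank≡ = trans (proj₂ (boxAt≡⇒ (toℕ k) (toℕ<n k) sameBox))
                  (trans (sym (proj₂ (boxAt≡⇒ (toℕ K) (toℕ<n K) refl))) rankK)

  opening-box : ∀ {r c} j (j<n : j < n) → stepAt p j ≡ opening r → openings r p j ≡ toℕ c →
                Φ (fromℕ< j<n) ≡ (r , c)
  opening-box {r} j j<n opens rank-j =
    trans (cong (boxAt b′ p) (toℕ-fromℕ< j<n))
          (boxAt≡ b′ p j (trans (cong rowOf opens) (rowOf-opening r)) (trans (openings-hit r p j opens) (cong suc rank-j)))

  horizontal-repeats : ∀ (K : Fin n) → isHoriz (stepAt p (toℕ K)) ≡ true → EarlierInBox Φ K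
  horizontal-repeats K horiz = earlier (nth-opening r p (toℕ K) c<rank)
    where
    r = rowOf (stepAt p (toℕ K))
    c = proj₂ (Φ K)
    rank≡ : openings r p (suc (toℕ K)) ≡ openings r p (toℕ K)
    rank≡ = openings-miss r p (toℕ K) (horizontal≢opening r _ horiz)
    c<rank : toℕ c < openings r p (toℕ K)
    c<rank = subst (toℕ c <_) (trans (sym (proj₂ (boxAt≡⇒ (toℕ K) (toℕ<n K) refl))) rank≡) ≤-refl
    earlier : ∃[ j ] (j < toℕ K × openings r p j ≡ toℕ c × stepAt p j ≡ opening r) → EarlierInBox Φ K
    earlier (j , j<K , rank-j , opens) =
      fromℕ< j<n , opening-box j j<n opens rank-j , subst (_< toℕ K) (sym (toℕ-fromℕ< j<n)) j<K
      where
      j<n : j < n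
      j<n = <-trans j<K (toℕ<n K)

  isMinEntry-Φ : ∀ K → isMinEntry Φ K ≡ not (isHoriz (stepAt p (toℕ K)))
  isMinEntry-Φ K with isHoriz (stepAt p (toℕ K)) in horiz
  ... | true = Equivalence.from (isMinEntry≡false⇔ Φ K) (horizontal-repeats K horiz)
  ... | false = Equivalence.from (isMinEntry≡true⇔ Φ K) (λ (k , sameBox , k<K) → opening-first K k horiz sameBox k<K)

  Γ-decode : Γ Φ ≡ p
  Γ-decode = stepAt-injective (Γ Φ) p (trans (length-Γ Φ) (sym length≡)) same-steps
    where
    same-steps : ∀ k → k < length (Γ Φ) → stepAt (Γ Φ) k ≡ stepAt p k
    same-steps k k< = begin
      stepAt (Γ Φ) k                                  ≡⟨ cong (stepAt (Γ Φ)) (sym (toℕ-fromℕ< k<n)) ⟩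
      stepAt (Γ Φ) (toℕ K)                            ≡⟨ stepAt-Γ Φ K ⟩
      rowStep (rowOf s) (isMinEntry Φ K)              ≡⟨ cong (rowStep (rowOf s)) (isMinEntry-Φ K) ⟩
      rowStep (rowOf s) (not (isHoriz s))             ≡⟨ rowStep-rowOf s ⟩
      s                                               ≡⟨ cong (stepAt p) (toℕ-fromℕ< k<n) ⟩
      stepAt p k                                      ∎
      where
      open ≡-Reasoning
      k<n : k < n
      k<n = subst (k <_) (length-Γ Φ) k<
      K = fromℕ< k<n
      s = stepAt p (toℕ K)

  opening-of : ∀ u → ∃[ J ] (Φ J ≡ u × isHoriz (stepAt p (toℕ J)) ≡ false)
  opening-of (r , c) with nth-opening r p n (subst (toℕ c <_) (sym (total r)) (toℕ<n c))
  ... | (j , j<n , rank-j , opens) =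
    fromℕ< j<n , opening-box j j<n opens rank-j ,
    trans (cong (λ i → isHoriz (stepAt p i)) (toℕ-fromℕ< j<n)) (trans (cong isHoriz opens) (isHoriz-opening r))

  opening-unique : ∀ (j j′ : Fin n) → Φ j ≡ Φ j′ →
    isHoriz (stepAt p (toℕ j)) ≡ false → isHoriz (stepAt p (toℕ j′)) ≡ false → j ≡ j′
  opening-unique j j′ sameBox opens opens′ with <-cmp (toℕ j) (toℕ j′)
  ... | tri< j<j′ _ _ = ⊥-elim (opening-first j′ j opens′ sameBox j<j′)
  ... | tri≈ _ j≡j′ _ = toℕ-injective j≡j′
  ... | tri> _ _ j>j′ = ⊥-elim (opening-first j j′ opens (sym sameBox) j>j′)

  horizontal : UniqueHorizontal p
  horizontal = unique-horizontal p (counts⇒horizontals≡1 C)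

  H : Fin n
  H = fromℕ< (subst (proj₁ horizontal <_) length≡ (proj₁ (proj₂ horizontal)))

  card-Φ : ∀ u → card Φ u ≡ bit (does (Φ H ≟B u)) + 1
  card-Φ u = begin
    card Φ u                                                  ≡⟨ length-filter-tabulate (λ j → Φ j ≟B u) (λ j → j) ⟩
    countFin n inBox                                          ≡⟨ countFin-split n inBox horiz ⟩
    countFin n (λ j → inBox j ∧ horiz j) + countFin n (λ j → inBox j ∧ not (horiz j))
                                                              ≡⟨ cong₂ _+_ only-H only-opening ⟩
    bit (inBox H) + 1                                         ∎
    where
    open ≡-Reasoning
    inBox horiz : Fin n → Bool
    inBox j = does (Φ j ≟B u)
    horiz j = isHoriz (stepAt p (toℕ j))

    H-horizontal : horiz H ≡ true
    H-horizontal = trans (cong (λ i → isHoriz (stepAt p i)) (toℕ-fromℕ< _)) (proj₁ (proj₂ (proj₂ horizontal)))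

    only-H : countFin n (λ j → inBox j ∧ horiz j) ≡ bit (inBox H)
    only-H = trans (countFin-unique n _ H is-H)
                   (trans (cong (λ m → bit (inBox H ∧ m)) H-horizontal) (cong bit (∧-identityʳ (inBox H))))
      where
      is-H : ∀ j → inBox j ∧ horiz j ≡ true → j ≡ H
      is-H j e = toℕ-injective (trans
        (proj₂ (proj₂ (proj₂ horizontal)) (toℕ j) (subst (toℕ j <_) (sym length≡) (toℕ<n j)) (proj₂ (∧≡true⇒ _ _ e)))
        (sym (toℕ-fromℕ< _)))

    only-opening : countFin n (λ j → inBox j ∧ not (horiz j)) ≡ 1
    only-opening with opening-of u
    ... | (a , a-box , a-opens) =
      trans (countFin-unique n _ a is-a) (cong₂ (λ x y → bit (x ∧ not y)) (dec-true (Φ a ≟B u) a-box) a-opens)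
      where
      is-a : ∀ j → inBox j ∧ not (horiz j) ≡ true → j ≡ a
      is-a j e = let (j-box , j-opens) = ∧≡true⇒ _ _ e in
        opening-unique j a (trans (does≡true⇒ (Φ j ≟B u) j-box) (sym a-box)) (not-injective {y = false} j-opens) a-opens

  top-step-gap : ∀ i → i < n → rowOf (stepAt p i) ≡ fzero → downs p i < ups p (suc i)
  top-step-gap i i< with stepAt p i in step
  ... | U = λ _ → subst (downs p i <_) (sym (openings-hit fzero p i step)) (s≤s (downs≤ups i (<⇒≤ i<)))
  ... | red = λ _ → <-≤-trans (red-above-axis i i< step) (openings-mono fzero p (n≤1+n i))
  ... | D = λ ()
  ... | blue = λ ()

  same-row-ordered : ∀ r {i j} {c c′ : Fin (suc b′)} →
    openings r p (suc i) ≡ suc (toℕ c) → openings r p (suc j) ≡ suc (toℕ c′) →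
    (r , c) ≢ (r , c′) → toℕ c ≤ toℕ c′ → i < j
  same-row-ordered r rank-i rank-j c≢c′ c≤c′ with m≤n⇒m<n∨m≡n c≤c′
  ... | inj₂ c≡c′ = ⊥-elim (c≢c′ (cong (r ,_) (toℕ-injective c≡c′)))
  ... | inj₁ c<c′ = s<s⁻¹ (openings-reflects-< r p (subst₂ _<_ (sym rank-i) (sym rank-j) (s≤s c<c′)))

  ordered-Φ : ∀ (u v : Box (suc b′)) → u ≢ v → u ≼ v → ∀ i j → Φ i ≡ u → Φ j ≡ v → toℕ i < toℕ j
  ordered-Φ (r , c) (r′ , c′) u≢v (r≤r′ , c≤c′) i j atU atV
    with boxAt≡⇒ (toℕ i) (toℕ<n i) atU | boxAt≡⇒ (toℕ j) (toℕ<n j) atV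
  ordered-Φ (fzero , c) (fzero , c′) u≢v (_ , c≤c′) i j _ _ | (_ , rank-i) | (_ , rank-j) =
    same-row-ordered fzero rank-i rank-j u≢v c≤c′
  ordered-Φ (fsuc fzero , c) (fsuc fzero , c′) u≢v (_ , c≤c′) i j _ _ | (_ , rank-i) | (_ , rank-j) =
    same-row-ordered (fsuc fzero) rank-i rank-j u≢v c≤c′
  ordered-Φ (fzero , c) (fsuc fzero , c′) u≢v (_ , c≤c′) i j _ _ | (top , rank-i) | (bottom , rank-j)
    with m≤n⇒m<n∨m≡n (≤-pred (openings-reflects-< (fsuc fzero) p (begin-strict
      downs p (toℕ i)         <⟨ top-step-gap (toℕ i) (toℕ<n i) top ⟩
      ups p (suc (toℕ i))     ≡⟨ rank-i ⟩
      suc (toℕ c)             ≤⟨ s≤s c≤c′ ⟩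
      suc (toℕ c′)            ≡⟨ sym rank-j ⟩
      downs p (suc (toℕ j))   ∎)))
    where open ≤-Reasoning
  ... | inj₁ i<j = i<j
  ... | inj₂ i≡j = ⊥-elim (0≢1+n (cong toℕ (trans (sym top) (trans (cong (λ k → rowOf (stepAt p k)) i≡j) bottom))))
  ordered-Φ (fsuc fzero , c) (fzero , c′) u≢v (() , _) i j _ _ | _ | _

  decode-SYT : IsSYT+1 Φ
  decode-SYT =
    (λ u → let (J , atU , _) = opening-of u in J , atU) ,
    (Φ H , trans (card-Φ (Φ H)) (cong (λ m → bit m + 1) (dec-true (Φ H ≟B Φ H) refl)) ,
      λ u u≢ΦH → trans (card-Φ u) (cong (λ m → bit m + 1) (dec-false (Φ H ≟B u) (λ e → u≢ΦH (sym e))))) ,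
    ordered-Φ

proposition5p2 : (b : ℕ) → 1 ≤ b →
    -- Γ maps SYT^{+1}(2×b) into RBMotz(2b+1;1)
    ((S : Filling b) → IsSYT+1 S → RBMotz (2 * b + 1) 1 (Γ S))
    -- Γ is injective on SYT^{+1}(2×b)
    × ((S S' : Filling b) → IsSYT+1 S → IsSYT+1 S' → Γ S ≡ Γ S' →
        (∀ j → S j ≡ S' j))
    -- Γ is onto RBMotz(2b+1;1)
    × ((p : List Step) → RBMotz (2 * b + 1) 1 p →
        Σ[ S ∈ Filling b ] (IsSYT+1 S × Γ S ≡ p))
proposition5p2 (suc b′) _ =
  (λ S (nonempty , _ , ordered) → counts⇒RBMotz (Tableau.Γ-counts S nonempty ordered)) ,
  (λ S S′ syt syt′ ΓS≡ΓS′ j →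
    trans (sym (decode-Γ b′ S syt j)) (trans (cong (λ p → decode b′ p j) ΓS≡ΓS′) (decode-Γ b′ S′ syt′ j))) ,
  (λ p motz → let open Decode b′ p (RBMotz⇒counts motz) in Φ , decode-SYT , Γ-decode)
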